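{- Let $n$, $a$, $q$, $r$ be integers with $n=qa+r$, $a\ge 4$, $q\ge 2$, and either ($a\le q+r+1$ and $0\le r\le a-2$) or ($a\le q+1$ and $r=a-1$). Then for every $(a-1)$-bounded independent broadcast $f$ on $\overrightarrow{C}(n;1,a)$, $$\sigma(f) \le n - |V_f^+| - (a-1)|V_f^1|,$$ where $V_f^+=\{v : f(v)>0\}$ and $V_f^1=\{v : f(v)=a-1\}$.
   Context: The oriented circulant graph $\overrightarrow{C}(n;1,a)$ has vertex set $\{v_0,\dots,v_{n-1}\}$ and arcs $v_iv_{i+1}$, $v_iv_{i+a}$, subscripts modulo $n$. $d(u,v)$ is the length of a shortest directed path from $u$ to $v$; $e(v)=\max_u d(v,u)$; $\mathrm{diam}$ is the maximum eccentricity. An independent broadcast is $f:V\to\{0,\dots,\mathrm{diam}\}$ with $f(v)\le e(v)$ for all $v$ and $d(u,v)>f(u)$ for all distinct $u,v$ with $f(u),f(v)>0$; its cost is $\sigma(f)=\sum_v f(v)$. It is $\ell$-bounded if $f(v)\le \ell$ for every $v$. -}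

module Defs where

open import Data.Nat using (ℕ; zero; suc; _+_; _*_; _∸_; _≤_; _<_; _≟_; _<?_)
open import Data.Fin using (Fin; toℕ)
open import Data.Nat.ListAction using (sum)
open import Data.List using (List; map; filter; length; allFin)
open import Data.Product using (Σ; ∃; _×_; ∃-syntax)
open import Data.Sum using (_⊎_)
open import Relation.Binary.PropositionalEquality using (_≡_; _≢_)
open import Relation.Nullary using (¬_)

-- x ≡ y (mod n), stated without division: x + k n = y + l n for some k l
CongMod : ℕ → ℕ → ℕ → Set
CongMod n x y = ∃[ k ] ∃[ l ] (x + k * n ≡ y + l * n)

Arc : (n a : ℕ) → Fin n → Fin n → Set
Arc n a u v = CongMod n (toℕ u + 1) (toℕ v) ⊎ CongMod n (toℕ u + a) (toℕ v)

data Walk (n a : ℕ) : Fin n → Fin n → ℕ → Set where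
  here : ∀ {u} → Walk n a u u 0
  step : ∀ {u w v k} → Arc n a u w → Walk n a w v k → Walk n a u v (suc k)

Dist : (n a : ℕ) → Fin n → Fin n → ℕ → Set
Dist n a u v k = Walk n a u v k × (∀ j → j < k → ¬ Walk n a u v j)

LeEcc : (n a : ℕ) → Fin n → ℕ → Set
LeEcc n a v m = ∃[ u ] ∃[ k ] (Dist n a v u k × m ≤ k)

-- independent broadcast on C(n;1,a)
-- (f(v) ≤ diam follows from f(v) ≤ e(v))
IsIndepBroadcast : (n a : ℕ) → (Fin n → ℕ) → Set
IsIndepBroadcast n a f =
  (∀ v → LeEcc n a v (f v)) ×
  (∀ u v → u ≢ v → 0 < f u → 0 < f v → ∀ k → Dist n a u v k → f u < k)

IsBounded : (n : ℕ) → ℕ → (Fin n → ℕ) → Set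
IsBounded n ℓ f = ∀ v → f v ≤ ℓ

cost : (n : ℕ) → (Fin n → ℕ) → ℕ
cost n f = sum (map f (allFin n))

card⁺ : (n : ℕ) → (Fin n → ℕ) → ℕ
card⁺ n f = length (filter (λ v → 0 <? f v) (allFin n))

cardEq : (n : ℕ) → (Fin n → ℕ) → ℕ → ℕ
cardEq n f m = length (filter (λ v → f v ≟ m) (allFin n))

{-# OPTIONS --safe #-}
-- Weigh each vertex v by f v + [f v > 0] + (a − 1)[f v = a − 1], so that the left-hand side
-- is the total weight. A broadcasting vertex v_i of weight w silences v_{i+1}, …, v_{i+w−1}:
-- if f v_i < a − 1 they lie within f v_i unit arcs of v_i, and if f v_i = a − 1 those beyond
-- v_{i+a−1} are reached by one a-arc followed by unit arcs. As w < 2a ≤ n, the blocks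
-- [i, i + w) of the broadcasting vertices are disjoint arcs of the n-cycle, so the total
-- weight is at most n.
module Submission where

open import Defs
open import Data.Bool using (true; false; if_then_else_)
open import Data.Nat using (ℕ; zero; suc; _+_; _*_; _∸_; _≤_; _<_; _≟_; _<?_; _≤?_; z≤n; s≤s; z<s; s≤s⁻¹; NonZero; >-nonZero; _/_; _%_)
open import Data.Nat.Properties
open import Data.Nat.DivMod using (_mod_; m%n<n; m<n⇒m%n≡m; [m+n]%n≡m%n; m≡m%n+[m/n]*n)
open import Data.Nat.Divisibility using (_∣_; n∣m*n; ∣m+n∣m⇒∣n; >⇒∤)
open import Data.Nat.Induction using (<-wellFounded)
open import Data.Nat.ListAction using (sum)
open import Data.Fin using (Fin; toℕ)
open import Data.Fin.Properties using (toℕ-fromℕ<; toℕ-injective; toℕ<n)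
open import Data.List using (List; []; _∷_; map; filter; length; allFin; tabulate)
open import Data.List.Properties using (map-tabulate)
open import Data.Product using (_×_; _,_; proj₂; ∃-syntax)
open import Data.Sum using (_⊎_; inj₁; inj₂)
open import Function using (_∘_; id)
open import Induction.WellFounded using (Acc; acc)
open import Relation.Nullary using (¬_; Dec; does; yes; no; contradiction)
open import Relation.Nullary.Decidable using (dec-true; dec-false)
open import Relation.Unary using (Pred; Decidable)
open import Relation.Binary.PropositionalEquality
open import Algebra.Properties.CommutativeSemigroup +-commutativeSemigroup using (x∙yz≈y∙xz; xy∙z≈xz∙y)

indicator : ∀ {p} {P : Set p} → Dec P → ℕ
indicator P? = if does P? then 1 else 0

module _ {a} {A : Set a} where

  sum-map-+ : ∀ (F G : A → ℕ) xs → sum (map (λ x → F x + G x) xs) ≡ sum (map F xs) + sum (map G xs)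
  sum-map-+ F G [] = refl
  sum-map-+ F G (x ∷ xs) = begin
    F x + G x + sum (map (λ x → F x + G x) xs)        ≡⟨ cong (F x + G x +_) (sum-map-+ F G xs) ⟩
    F x + G x + (sum (map F xs) + sum (map G xs))     ≡⟨ +-assoc (F x) (G x) _ ⟩
    F x + (G x + (sum (map F xs) + sum (map G xs)))   ≡⟨ cong (F x +_) (x∙yz≈y∙xz (G x) (sum (map F xs)) _) ⟩
    F x + (sum (map F xs) + (G x + sum (map G xs)))   ≡⟨ +-assoc (F x) _ _ ⟨
    F x + sum (map F xs) + (G x + sum (map G xs))     ∎
    where open ≡-Reasoning

  sum-map-* : ∀ c (F : A → ℕ) xs → sum (map (λ x → c * F x) xs) ≡ c * sum (map F xs)
  sum-map-* c F [] = sym (*-zeroʳ c)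
  sum-map-* c F (x ∷ xs) =
    trans (cong (c * F x +_) (sum-map-* c F xs)) (sym (*-distribˡ-+ c (F x) _))

  length-filter≡sum-indicator : ∀ {p} {P : Pred A p} (P? : Decidable P) xs →
    length (filter P? xs) ≡ sum (map (indicator ∘ P?) xs)
  length-filter≡sum-indicator P? [] = refl
  length-filter≡sum-indicator P? (x ∷ xs) with does (P? x)
  ... | true  = cong suc (length-filter≡sum-indicator P? xs)
  ... | false = length-filter≡sum-indicator P? xs

windowSum : (ℕ → ℕ) → ℕ → ℕ → ℕ
windowSum h k zero = 0
windowSum h k (suc len) = h k + windowSum h (suc k) len

sum-tabulate≡windowSum : ∀ {n} (F : Fin n → ℕ) h k → (∀ x → F x ≡ h (k + toℕ x)) →
  sum (tabulate F) ≡ windowSum h k n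
sum-tabulate≡windowSum {zero} F h k F≗h = refl
sum-tabulate≡windowSum {suc n} F h k F≗h = cong₂ _+_
  (trans (F≗h Fin.zero) (cong h (+-identityʳ k)))
  (sum-tabulate≡windowSum (F ∘ Fin.suc) h (suc k) λ x → trans (F≗h (Fin.suc x)) (cong h (+-suc k (toℕ x))))
  where import Data.Fin as Fin

windowSum-++ : ∀ h k m l → windowSum h k (m + l) ≡ windowSum h k m + windowSum h (k + m) l
windowSum-++ h k zero l = cong (λ j → windowSum h j l) (sym (+-identityʳ k))
windowSum-++ h k (suc m) l = begin
  h k + windowSum h (suc k) (m + l)                                ≡⟨ cong (h k +_) (windowSum-++ h (suc k) m l) ⟩
  h k + (windowSum h (suc k) m + windowSum h (suc k + m) l)        ≡⟨ +-assoc (h k) _ _ ⟨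
  h k + windowSum h (suc k) m + windowSum h (suc k + m) l          ≡⟨ cong (λ j → h k + windowSum h (suc k) m + windowSum h j l) (+-suc k m) ⟨
  h k + windowSum h (suc k) m + windowSum h (k + suc m) l          ∎
  where open ≡-Reasoning

windowSum-zero : ∀ h k len → (∀ d → d < len → h (k + d) ≡ 0) → windowSum h k len ≡ 0
windowSum-zero h k zero _ = refl
windowSum-zero h k (suc len) silent = cong₂ _+_
  (trans (cong h (sym (+-identityʳ k))) (silent 0 z<s))
  (windowSum-zero h (suc k) len λ d d<len → trans (cong h (sym (+-suc k d))) (silent (suc d) (s≤s d<len)))

windowSum-positive : ∀ h k len → 0 < windowSum h k len → ∃[ p ] 0 < h p
windowSum-positive h k (suc len) pos with 0 <? h k
... | yes hk>0 = k , hk>0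
... | no hk≯0 = windowSum-positive h (suc k) len
  (subst (λ x → 0 < x + windowSum h (suc k) len) (n≤0⇒n≡0 (≮⇒≥ hk≯0)) pos)

module _ {h : ℕ → ℕ} {n : ℕ} (periodic : ∀ i → h (i + n) ≡ h i) where

  windowSum-rotate : ∀ k → windowSum h k n ≡ windowSum h (suc k) n
  windowSum-rotate k = +-cancelʳ-≡ (h k) _ _ (begin
    windowSum h k n + h k                     ≡⟨ cong (windowSum h k n +_) (trans (+-identityʳ (h (k + n))) (periodic k)) ⟨
    windowSum h k n + windowSum h (k + n) 1   ≡⟨ windowSum-++ h k n 1 ⟨
    windowSum h k (n + 1)                     ≡⟨ cong (windowSum h k) (+-comm n 1) ⟩
    h k + windowSum h (suc k) n               ≡⟨ +-comm (h k) _ ⟩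
    windowSum h (suc k) n + h k               ∎)
    where open ≡-Reasoning

  windowSum-from : ∀ p → windowSum h 0 n ≡ windowSum h p n
  windowSum-from zero = refl
  windowSum-from (suc p) = trans (windowSum-from p) (windowSum-rotate p)

Blocking : (ℕ → ℕ) → Set
Blocking h = ∀ k d → 0 < d → d < h k → h (k + d) ≡ 0

BlocksWithin : (ℕ → ℕ) → ℕ → ℕ → Set
BlocksWithin h k e = ∀ i → k ≤ i → i < e → i + h i ≤ e

module _ {h : ℕ → ℕ} (blocking : Blocking h) where

  windowSum-inside-block : ∀ k l → l < h k → windowSum h (suc k) l ≡ 0
  windowSum-inside-block k l l<hk = windowSum-zero h (suc k) l λ d d<l →
    trans (cong h (sym (+-suc k d))) (blocking k (suc d) z<s (<-≤-trans (s≤s d<l) l<hk))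

  leading-block : ∀ k len → 0 < len → h k ≤ len → ∃[ m ] 0 < m × m ≤ len × windowSum h k m ≤ m
  leading-block k len len>0 hk≤len with h k in hk≡
  ... | zero  = 1 , z<s , len>0 , ≤-trans (≤-reflexive (cong (_+ 0) hk≡)) z≤n
  ... | suc c = suc c , z<s , hk≤len , ≤-reflexive (begin
    h k + windowSum h (suc k) c   ≡⟨ cong₂ _+_ hk≡ (windowSum-inside-block k c (≤-reflexive (sym hk≡))) ⟩
    suc c + 0                     ≡⟨ +-identityʳ (suc c) ⟩
    suc c                         ∎)
    where open ≡-Reasoning

  windowSum-≤-length : ∀ k len → Acc _<_ len → BlocksWithin h k (k + len) → windowSum h k len ≤ len
  windowSum-≤-length k zero _ _ = z≤n
  windowSum-≤-length k len@(suc _) (acc rs) within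
    with leading-block k len z<s (+-cancelˡ-≤ k _ _ (within k ≤-refl (m<m+n k z<s)))
  ... | m , m>0 , m≤len , block≤m = begin
    windowSum h k len                                ≡⟨ cong (windowSum h k) (m+[n∸m]≡n m≤len) ⟨
    windowSum h k (m + r)                            ≡⟨ windowSum-++ h k m r ⟩
    windowSum h k m + windowSum h (k + m) r          ≤⟨ +-mono-≤ block≤m (windowSum-≤-length (k + m) r (rs r<len) rest-within) ⟩
    m + r                                            ≡⟨ m+[n∸m]≡n m≤len ⟩
    len                                              ∎
    where
    open ≤-Reasoning
    r : ℕ
    r = len ∸ m
    r<len : r < len
    r<len = ∸-monoʳ-< m>0 m≤len
    rest-within : BlocksWithin h (k + m) (k + m + r)
    rest-within = subst (BlocksWithin h (k + m))
      (sym (trans (+-assoc k m r) (cong (k +_) (m+[n∸m]≡n m≤len))))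
      (λ i k+m≤i → within i (≤-trans (m≤m+n k m) k+m≤i))

  module _ {n : ℕ} (periodic : ∀ i → h (i + n) ≡ h i) where

    -- A block running past p + n would silence position p + n, which is p again.
    blocksWithin-period : ∀ p → 0 < h p → BlocksWithin h p (p + n)
    blocksWithin-period p hp>0 i _ i<p+n with i + h i ≤? p + n
    ... | yes fits = fits
    ... | no overflows = contradiction (begin
      h p              ≡⟨ periodic p ⟨
      h (p + n)        ≡⟨ cong h i+gap≡p+n ⟨
      h (i + gap)      ≡⟨ blocking i gap (m<n⇒0<n∸m i<p+n) gap<hi ⟩
      0                ∎) (>⇒≢ hp>0)
      where
      open ≡-Reasoning
      gap : ℕ
      gap = p + n ∸ i
      i+gap≡p+n : i + gap ≡ p + n
      i+gap≡p+n = m+[n∸m]≡n (<⇒≤ i<p+n)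
      gap<hi : gap < h i
      gap<hi = +-cancelˡ-< i gap (h i) (subst (_< i + h i) (sym i+gap≡p+n) (≰⇒> overflows))

    windowSum-period-≤ : windowSum h 0 n ≤ n
    windowSum-period-≤ with 0 <? windowSum h 0 n
    ... | no ¬pos = ≤-trans (≮⇒≥ ¬pos) z≤n
    ... | yes pos with windowSum-positive h 0 n pos
    ...   | p , hp>0 = ≤-trans (≤-reflexive (windowSum-from periodic p))
                         (windowSum-≤-length p n (<-wellFounded n) (blocksWithin-period p hp>0))

-- Existence of a walk of given length is not decidable, so a shortest walk (as Dist requires)
-- is only obtained under double negation; that is enough to refute a positive broadcast value.
¬¬-least : ∀ {p} {P : ℕ → Set p} {j} → P j → ¬ ¬ (∃[ k ] k ≤ j × P k × (∀ i → i < k → ¬ P i))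
¬¬-least {P = P} {j} = go (<-wellFounded j)
  where
  go : ∀ {j} → Acc _<_ j → P j → ¬ ¬ (∃[ k ] k ≤ j × P k × (∀ i → i < k → ¬ P i))
  go {j} (acc rs) pj none = none (j , ≤-refl , pj , λ i i<j pi →
    go (rs i<j) pi λ (k , k≤i , pk , least) → none (k , ≤-trans k≤i (<⇒≤ i<j) , pk , least))

congMod-+⇒∣ : ∀ {n} r d → CongMod n (r + d) r → n ∣ d
congMod-+⇒∣ {n} r d (k , l , eq) = ∣m+n∣m⇒∣n (subst (n ∣_) (sym kn+d≡ln) (n∣m*n l)) (n∣m*n k)
  where
  kn+d≡ln : k * n + d ≡ l * n
  kn+d≡ln = trans (+-comm (k * n) d) (+-cancelˡ-≡ r _ _ (trans (sym (+-assoc r d (k * n))) eq))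

module _ {n : ℕ} ⦃ _ : NonZero n ⦄ where

  vertex : ℕ → Fin n
  vertex i = i mod n

  toℕ-vertex : ∀ i → toℕ (vertex i) ≡ i % n
  toℕ-vertex i = toℕ-fromℕ< (m%n<n i n)

  vertex-toℕ : ∀ x → vertex (toℕ x) ≡ x
  vertex-toℕ x = toℕ-injective (trans (toℕ-vertex (toℕ x)) (m<n⇒m%n≡m (toℕ<n x)))

  vertex-+n : ∀ i → vertex (i + n) ≡ vertex i
  vertex-+n i = toℕ-injective (trans (toℕ-vertex (i + n)) (trans ([m+n]%n≡m%n i n) (sym (toℕ-vertex i))))

  congMod-vertex-+ : ∀ i s → CongMod n (toℕ (vertex i) + s) (toℕ (vertex (i + s)))
  congMod-vertex-+ i s = i / n , (i + s) / n , (begin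
    toℕ (vertex i) + s + i / n * n       ≡⟨ cong (λ x → x + s + i / n * n) (toℕ-vertex i) ⟩
    i % n + s + i / n * n                ≡⟨ xy∙z≈xz∙y (i % n) s (i / n * n) ⟩
    i % n + i / n * n + s                ≡⟨ cong (_+ s) (m≡m%n+[m/n]*n i n) ⟨
    i + s                                ≡⟨ m≡m%n+[m/n]*n (i + s) n ⟩
    (i + s) % n + (i + s) / n * n        ≡⟨ cong (_+ (i + s) / n * n) (toℕ-vertex (i + s)) ⟨
    toℕ (vertex (i + s)) + (i + s) / n * n ∎)
    where open ≡-Reasoning

  vertex-+-≢ : ∀ i d → 0 < d → d < n → vertex i ≢ vertex (i + d)
  vertex-+-≢ i d d>0 d<n same = >⇒∤ ⦃ >-nonZero d>0 ⦄ d<n (congMod-+⇒∣ (toℕ (vertex i)) d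
    (subst (λ v → CongMod n (toℕ (vertex i) + d) (toℕ v)) (sym same) (congMod-vertex-+ i d)))

  module _ {a : ℕ} where

    forward-walk : ∀ i d → Walk n a (vertex i) (vertex (i + d)) d
    forward-walk i zero = subst (λ j → Walk n a (vertex i) (vertex j) 0) (sym (+-identityʳ i)) here
    forward-walk i (suc d) = subst (λ j → Walk n a (vertex i) (vertex j) (suc d)) (+-assoc i 1 d)
      (step (inj₁ (congMod-vertex-+ i 1)) (forward-walk (i + 1) d))

    jump-walk : ∀ i d → a ≤ d → Walk n a (vertex i) (vertex (i + d)) (suc (d ∸ a))
    jump-walk i d a≤d = subst (λ j → Walk n a (vertex i) (vertex j) (suc (d ∸ a)))
      (trans (+-assoc i a (d ∸ a)) (cong (i +_) (m+[n∸m]≡n a≤d)))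
      (step (inj₂ (congMod-vertex-+ i a)) (forward-walk (i + a) (d ∸ a)))

module _ {n a : ℕ} {f : Fin n → ℕ} (ib : IsIndepBroadcast n a f) where

  silent-within-reach : ∀ {u v len} → u ≢ v → 0 < f u → Walk n a u v len → len ≤ f u → f v ≡ 0
  silent-within-reach u≢v fu>0 walk len≤fu = n≤0⇒n≡0 (≮⇒≥ λ fv>0 →
    ¬¬-least walk λ (k , k≤len , dist) →
      <⇒≱ (proj₂ ib _ _ u≢v fu>0 fv>0 k dist) (≤-trans k≤len len≤fu))

weight : ℕ → ℕ → ℕ
weight b x = x + indicator (0 <? x) + b * indicator (x ≟ b)

weight-zero : ∀ b → weight b 0 ≡ 0
weight-zero zero = refl
weight-zero (suc b) = *-zeroʳ (suc b)

weight-cases : ∀ b x → 0 < x → (x ≢ b × weight b x ≡ suc x) ⊎ (x ≡ b × weight b x ≡ suc b + b)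
weight-cases b x@(suc _) _ with x ≟ b
... | no x≢b = inj₁ (x≢b , (begin
  x + 1 + b * indicator (x ≟ b)     ≡⟨ cong (λ t → x + 1 + b * (if t then 1 else 0)) (dec-false (x ≟ b) x≢b) ⟩
  x + 1 + b * 0                     ≡⟨ cong (x + 1 +_) (*-zeroʳ b) ⟩
  x + 1 + 0                         ≡⟨ +-identityʳ (x + 1) ⟩
  x + 1                             ≡⟨ +-comm x 1 ⟩
  suc x                             ∎))
  where open ≡-Reasoning
... | yes refl = inj₂ (refl , (begin
  x + 1 + x * indicator (x ≟ x)     ≡⟨ cong (λ t → x + 1 + x * (if t then 1 else 0)) (dec-true (x ≟ x) refl) ⟩
  x + 1 + x * 1                     ≡⟨ cong₂ _+_ (+-comm x 1) (*-identityʳ x) ⟩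
  suc x + x                         ∎))
  where open ≡-Reasoning

weight-≤ : ∀ b x → x ≤ b → weight b x ≤ suc b + b
weight-≤ b zero _ = ≤-trans (≤-reflexive (weight-zero b)) z≤n
weight-≤ b x@(suc _) x≤b with weight-cases b x z<s
... | inj₁ (_ , w≡) = ≤-trans (≤-reflexive w≡) (≤-trans (s≤s x≤b) (m≤m+n (suc b) b))
... | inj₂ (_ , w≡) = ≤-reflexive w≡

module _ {n b : ℕ} ⦃ _ : NonZero n ⦄ where

  walk-within-weight : ∀ i x d → 0 < x → d < weight b x →
    ∃[ len ] len ≤ x × Walk n (suc b) (vertex i) (vertex (i + d)) len
  walk-within-weight i x d x>0 d<w with d ≤? x
  ... | yes d≤x = d , d≤x , forward-walk i d
  ... | no d≰x with weight-cases b x x>0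
  ...   | inj₁ (_ , w≡) = contradiction (s≤s⁻¹ (subst (d <_) w≡ d<w)) d≰x
  ...   | inj₂ (refl , w≡) =
    suc (d ∸ suc x) , m<n+o⇒m∸n<o d (suc x) ⦃ >-nonZero x>0 ⦄ (subst (d <_) w≡ d<w) , jump-walk i d (≰⇒> d≰x)

  module _ {f : Fin n → ℕ} (ib : IsIndepBroadcast n (suc b) f) (bounded : IsBounded n b f)
           (n≥2a : suc b + suc b ≤ n) where

    blocking-weight : Blocking (weight b ∘ f ∘ vertex)
    blocking-weight k d d>0 d<w =
      let len , len≤ , walk = walk-within-weight k (f (vertex k)) d fk>0 d<w
      in trans (cong (weight b) (silent-within-reach ib (vertex-+-≢ k d d>0 d<n) fk>0 walk len≤)) (weight-zero b)
      where
      fk>0 : 0 < f (vertex k)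
      fk>0 = n≢0⇒n>0 λ fk≡0 → n≮0 (subst (d <_) (trans (cong (weight b) fk≡0) (weight-zero b)) d<w)
      d<n : d < n
      d<n = <-trans (<-≤-trans d<w (weight-≤ b _ (bounded (vertex k))))
                    (<-≤-trans (+-monoʳ-< (suc b) (n<1+n b)) n≥2a)

cost+counts≡sum-weight : ∀ n b (f : Fin n → ℕ) →
  cost n f + card⁺ n f + b * cardEq n f b ≡ sum (map (weight b ∘ f) (allFin n))
cost+counts≡sum-weight n b f = begin
  sum (map f vs) + length (filter pos? vs) + b * length (filter top? vs)
    ≡⟨ cong₂ (λ s t → sum (map f vs) + s + b * t)
         (length-filter≡sum-indicator pos? vs) (length-filter≡sum-indicator top? vs) ⟩
  sum (map f vs) + sum (map (indicator ∘ pos?) vs) + b * sum (map (indicator ∘ top?) vs)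
    ≡⟨ cong (sum (map f vs) + sum (map (indicator ∘ pos?) vs) +_) (sum-map-* b (indicator ∘ top?) vs) ⟨
  sum (map f vs) + sum (map (indicator ∘ pos?) vs) + sum (map (λ v → b * indicator (top? v)) vs)
    ≡⟨ cong (_+ sum (map (λ v → b * indicator (top? v)) vs)) (sum-map-+ f (indicator ∘ pos?) vs) ⟨
  sum (map (λ v → f v + indicator (pos? v)) vs) + sum (map (λ v → b * indicator (top? v)) vs)
    ≡⟨ sum-map-+ (λ v → f v + indicator (pos? v)) (λ v → b * indicator (top? v)) vs ⟨
  sum (map (weight b ∘ f) vs) ∎
  where
  open ≡-Reasoning
  vs : List (Fin n)
  vs = allFin n
  pos? : ∀ v → Dec (0 < f v)
  pos? v = 0 <? f v
  top? : ∀ v → Dec (f v ≡ b)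
  top? v = f v ≟ b

broadcast-cost-≤ : ∀ {n b} (f : Fin n → ℕ) → suc b + suc b ≤ n →
  IsIndepBroadcast n (suc b) f → IsBounded n b f →
  cost n f + card⁺ n f + b * cardEq n f b ≤ n
broadcast-cost-≤ {n} {b} f n≥2a ib bounded = begin
  cost n f + card⁺ n f + b * cardEq n f b   ≡⟨ cost+counts≡sum-weight n b f ⟩
  sum (map (weight b ∘ f) (allFin n))       ≡⟨ cong sum (map-tabulate id (weight b ∘ f)) ⟩
  sum (tabulate (weight b ∘ f))             ≡⟨ sum-tabulate≡windowSum _ _ 0 (λ x → cong (weight b ∘ f) (sym (vertex-toℕ x))) ⟩
  windowSum (weight b ∘ f ∘ vertex) 0 n     ≤⟨ windowSum-period-≤ (blocking-weight ib bounded n≥2a)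
                                                 (λ i → cong (weight b ∘ f) (vertex-+n i)) ⟩
  n                                         ∎
  where
  open ≤-Reasoning
  instance
    n≢0 : NonZero n
    n≢0 = >-nonZero (<-≤-trans z<s n≥2a)

proposition16 : (n a q r : ℕ) → n ≡ q * a + r → 4 ≤ a → 2 ≤ q →
    ((a ≤ q + r + 1 × r ≤ a ∸ 2) ⊎ (a ≤ q + 1 × r ≡ a ∸ 1)) →
    (f : Fin n → ℕ) → IsIndepBroadcast n a f → IsBounded n (a ∸ 1) f →
    cost n f + card⁺ n f + (a ∸ 1) * cardEq n f (a ∸ 1) ≤ n
proposition16 _ zero _ _ _ ()
proposition16 n (suc b) q r n≡qa+r _ q≥2 _ f ib bounded = broadcast-cost-≤ f n≥2a ib bounded
  where
  n≥2a : suc b + suc b ≤ n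
  n≥2a = begin
    suc b + suc b          ≡⟨ cong (suc b +_) (+-identityʳ (suc b)) ⟨
    2 * suc b              ≤⟨ *-monoˡ-≤ (suc b) q≥2 ⟩
    q * suc b              ≤⟨ m≤m+n (q * suc b) r ⟩
    q * suc b + r          ≡⟨ n≡qa+r ⟨
    n                      ∎
    where open ≤-Reasoning
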